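{- Let $(\mathbb{F},\mathcal{R})$ be a simply-typed term rewriting system (STRS) that is compatible with a cost-size interpretation. Then for all valuations $\alpha$ and $\zeta$ and all terms $s,t$ (such that the quantities below are defined) with $s \to_{\mathcal{R}} t$ (one innermost rewrite step), we have $\mathcal{C}'(s)_{\alpha,\zeta} > \mathcal{C}'(t)_{\alpha,\zeta}$ and $[\![s]\!]^{\mathsf{s}}_\alpha \sqsupseteq [\![t]\!]^{\mathsf{s}}_\alpha$.
   Context: Types: fix a nonempty set $\mathbb{B}$ of base types; simple types are $\sigma ::= \iota \mid \sigma \Rightarrow \sigma$ ($\iota\in\mathbb{B}$, $\Rightarrow$ right-associative); order $\mathrm{ord}(\iota)=0$, $\mathrm{ord}(\sigma\Rightarrow\tau)=\max(1+\mathrm{ord}(\sigma),\mathrm{ord}(\tau))$. A signature assigns to each function symbol $\mathsf{f}$ a type of order at most 2, which can be written $\mathsf{f} : (\vec\iota_1\Rightarrow\kappa_1)\Rightarrow\cdots\Rightarrow(\vec\iota_k\Rightarrow\kappa_k)\Rightarrow\nu_1\Rightarrow\cdots\Rightarrow\nu_l\Rightarrow\iota$ with all $\iota$'s, $\kappa$'s, $\nu$'s base types. For each type there are countably many typed variables. Terms are applicative: variables, function symbols, and well-typed applications $s\,t$ (left-associative). A rewrite rule $\ell\to r$ is a pair of terms of the same base type with $\ell=\mathsf{f}\,\ell_1\cdots\ell_m$ and every variable of $r$ occurring in $\ell$; an STRS is a set $\mathcal{R}$ of such rules. A redex is an instance $\ell\gamma$ of a left-hand side. The innermost rewrite relation: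 $\ell\gamma\to_{\mathcal{R}} r\gamma$ if $\ell\to r\in\mathcal{R}$ and no proper subterm of $\ell\gamma$ is a redex; and if $s\to_{\mathcal{R}} u$ then $s\,t\to_{\mathcal{R}} u\,t$ and $t\,s\to_{\mathcal{R}} t\,u$. Normal form means irreducible for $\to_{\mathcal{R}}$. Cost-size interpretations: for each base type $\iota$ a quasi-ordered set $(\mathcal{S}_\iota,\sqsupseteq_\iota)$ is chosen; $\mathcal{S}_{\sigma\Rightarrow\tau}$ is the set of order-preserving functions $\mathcal{S}_\sigma\to\mathcal{S}_\tau$, ordered by $f\sqsupseteq g$ iff $f(x)\sqsupseteq g(x)$ for all $x$. For types of order $\le 2$: $\mathcal{C}_\kappa=\mathbb{N}$ for $\kappa$ base; $\mathcal{C}_{\iota\Rightarrow\tau}=\mathcal{S}_\iota\Longrightarrow\mathcal{C}_\tau$ for $\iota$ base; $\mathcal{C}_{\sigma\Rightarrow\tau}=\mathcal{C}_\sigma\Longrightarrow\mathcal{S}_\sigma\Longrightarrow\mathcal{C}_\tau$ if $\mathrm{ord}(\sigma)=1$, where $A\Longrightarrow B$ denotes order-preserving functions. A cost-size interpretation assigns to each symbol $\mathsf{f}$ of type $\sigma$ a size $\mathcal{J}^{\mathsf{s}}_{\mathsf{f}}\in\mathcal{S}_\sigma$ and a cost $\mathcal{J}^{\mathsf{c}}_{\mathsf{f}}\in\mathcal{C}_\sigma$. Given valuations $\alpha$ (mapping variables of type $\sigma$ into $\mathcal{S}_\sigma$) and $\zeta$ (mapping variables of type $\sigma$ into $\mathcal{C}_\sigma$):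 $[\![x]\!]^{\mathsf{s}}_\alpha=\alpha(x)$, $[\![\mathsf{f}]\!]^{\mathsf{s}}_\alpha=\mathcal{J}^{\mathsf{s}}_{\mathsf{f}}$, $[\![s\,t]\!]^{\mathsf{s}}_\alpha=[\![s]\!]^{\mathsf{s}}_\alpha([\![t]\!]^{\mathsf{s}}_\alpha)$. For terms $s$ such that $s$ and all its variables have type order $0$ or $1$, the cost is $[\![x\,s_1\cdots s_n]\!]^{\mathsf{c}}_{\alpha,\zeta}=\zeta(x)([\![s_1]\!]^{\mathsf{s}}_\alpha,\dots,[\![s_n]\!]^{\mathsf{s}}_\alpha)$ and $[\![\mathsf{f}\,s_1\cdots s_k\,t_1\cdots t_n]\!]^{\mathsf{c}}_{\alpha,\zeta}=\mathcal{J}^{\mathsf{c}}_{\mathsf{f}}([\![s_1]\!]^{\mathsf{c}}_{\alpha,\zeta},[\![s_1]\!]^{\mathsf{s}}_\alpha,\dots,[\![s_k]\!]^{\mathsf{c}}_{\alpha,\zeta},[\![s_k]\!]^{\mathsf{s}}_\alpha,[\![t_1]\!]^{\mathsf{s}}_\alpha,\dots,[\![t_n]\!]^{\mathsf{s}}_\alpha)$, where $s_1,\dots,s_k$ are the $k$ order-1 arguments of $\mathsf{f}$ and $t_1,\dots,t_n$ ($n\le l$) its base-type arguments. Define $\mathcal{C}(s)_{\alpha,\zeta}=\sum\{[\![t]\!]^{\mathsf{c}}_{\alpha,\zeta}\mid t \text{ a subterm of } s,\ t \text{ not a variable},\ t\text{ of base type}\}$ and $\mathcal{C}'(s)_{\alpha,\zeta}=\sum\{[\![t]\!]^{\mathsf{c}}_{\alpha,\zeta}\mid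 t\text{ a subterm of }s,\ t\text{ not a variable, of base type, not in normal form}\}$. The STRS is compatible with the interpretation if for every rule $\ell\to r$ and all valuations $\alpha,\zeta$: $[\![\ell]\!]^{\mathsf{c}}_{\alpha,\zeta}>\mathcal{C}(r)_{\alpha,\zeta}$ and $[\![\ell]\!]^{\mathsf{s}}_\alpha\sqsupseteq[\![r]\!]^{\mathsf{s}}_\alpha$. -}

module Defs where

open import Data.Nat using (ℕ; zero; suc; _+_; _≤_; _<_; _⊔_)
open import Data.Product using (Σ; _×_; _,_; proj₁; proj₂)
open import Relation.Nullary using (¬_; Dec; yes; no)

infixr 5 _⇒_
data Ty (B : Set) : Set where
  base : B → Ty B
  _⇒_  : Ty B → Ty B → Ty B

ord : ∀ {B} → Ty B → ℕ
ord (base _) = 0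
ord (σ ⇒ τ)  = suc (ord σ) ⊔ ord τ

record QuasiOrder : Set₁ where
  field
    Carrier  : Set
    _⊒_      : Carrier → Carrier → Set
    ⊒-refl   : ∀ {x} → x ⊒ x
    ⊒-trans  : ∀ {x y z} → x ⊒ y → y ⊒ z → x ⊒ z

module Framework {B : Set} (F : Set) (ty : F → Ty B) where

  -- Applicative terms; variables of type σ are named by natural numbers
  -- (countably many variables per type).  The variable (σ , n) is var {σ} n.

  data Tm : Ty B → Set where
    var : ∀ {σ} → ℕ → Tm σ
    fun : (f : F) → Tm (ty f)
    app : ∀ {σ τ} → Tm (σ ⇒ τ) → Tm σ → Tm τ

  data Occ (ρ : Ty B) (n : ℕ) : {σ : Ty B} → Tm σ → Set where
    here : Occ ρ n (var {ρ} n)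
    inL  : ∀ {σ τ} {s : Tm (σ ⇒ τ)} {t : Tm σ} → Occ ρ n s → Occ ρ n (app s t)
    inR  : ∀ {σ τ} {s : Tm (σ ⇒ τ)} {t : Tm σ} → Occ ρ n t → Occ ρ n (app s t)

  VarsOrd≤1 : ∀ {σ} → Tm σ → Set
  VarsOrd≤1 s = ∀ ρ n → Occ ρ n s → ord ρ ≤ 1

  data FunHeaded : {σ : Ty B} → Tm σ → Set where
    fun : (f : F) → FunHeaded (fun f)
    app : ∀ {σ τ} {s : Tm (σ ⇒ τ)} {t : Tm σ} → FunHeaded s → FunHeaded (app s t)

  data _⊴_ {σ : Ty B} (u : Tm σ) : {τ : Ty B} → Tm τ → Set where
    ⊴-refl : u ⊴ u
    ⊴-appL : ∀ {ρ τ} {s : Tm (ρ ⇒ τ)} {t : Tm ρ} → u ⊴ s → u ⊴ app s t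
    ⊴-appR : ∀ {ρ τ} {s : Tm (ρ ⇒ τ)} {t : Tm ρ} → u ⊴ t → u ⊴ app s t

  data _◁_ {σ : Ty B} (u : Tm σ) : {τ : Ty B} → Tm τ → Set where
    ◁-appL : ∀ {ρ τ} {s : Tm (ρ ⇒ τ)} {t : Tm ρ} → u ⊴ s → u ◁ app s t
    ◁-appR : ∀ {ρ τ} {s : Tm (ρ ⇒ τ)} {t : Tm ρ} → u ⊴ t → u ◁ app s t

  record Rule : Set where
    field
      rty      : B
      lhs      : Tm (base rty)
      rhs      : Tm (base rty)
      lhs-head : FunHeaded lhs
      rhs-vars : ∀ ρ n → Occ ρ n rhs → Occ ρ n lhs

  Subst : Set
  Subst = (σ : Ty B) → ℕ → Tm σ

  _⟨_⟩ : ∀ {σ} → Tm σ → Subst → Tm σ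
  var {σ} n ⟨ γ ⟩ = γ σ n
  fun f ⟨ γ ⟩     = fun f
  app s t ⟨ γ ⟩   = app (s ⟨ γ ⟩) (t ⟨ γ ⟩)

  module Rewriting (R : Rule → Set) where

    data Redex : {σ : Ty B} → Tm σ → Set where
      redex : ∀ {ρ} → R ρ → (γ : Subst) → Redex (Rule.lhs ρ ⟨ γ ⟩)

    infix 4 _⟶_
    data _⟶_ : {σ : Ty B} → Tm σ → Tm σ → Set where
      root : ∀ {ρ} → R ρ → (γ : Subst)
           → (∀ {τ} (u : Tm τ) → u ◁ (Rule.lhs ρ ⟨ γ ⟩) → ¬ Redex u)
           → Rule.lhs ρ ⟨ γ ⟩ ⟶ Rule.rhs ρ ⟨ γ ⟩
      appL : ∀ {σ τ} {s u : Tm (σ ⇒ τ)} {t : Tm σ} → s ⟶ u → app s t ⟶ app u t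
      appR : ∀ {σ τ} {t : Tm (σ ⇒ τ)} {s u : Tm σ} → s ⟶ u → app t s ⟶ app t u

    NF : ∀ {σ} → Tm σ → Set
    NF s = ∀ t → ¬ (s ⟶ t)

  module Domains (Q : B → QuasiOrder) where

    mutual
      S : Ty B → Set
      S (base b) = QuasiOrder.Carrier (Q b)
      S (σ ⇒ τ)  = Σ (S σ → S τ) λ f → ∀ {x y} → Geq σ x y → Geq τ (f x) (f y)

      Geq : (σ : Ty B) → S σ → S σ → Set
      Geq (base b) x y = QuasiOrder._⊒_ (Q b) x y
      Geq (σ ⇒ τ)  f g = ∀ x → Geq τ (proj₁ f x) (proj₁ g x)

    syntax Geq σ x y = x ⊒[ σ ] y

    -- cost domains; the clauses follow C_κ = ℕ,
    -- C_{ι⇒τ} = S_ι ⟹ C_τ, C_{σ⇒τ} = C_σ ⟹ S_σ ⟹ C_τ (σ not base),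
    -- ordered pointwise by ≥ on ℕ
    mutual
      C : Ty B → Set
      C (base b) = ℕ
      C (base b ⇒ τ) =
        Σ (S (base b) → C τ) λ f → ∀ {x y} → Geq (base b) x y → Cge τ (f x) (f y)
      C ((σ₁ ⇒ σ₂) ⇒ τ) =
        Σ (C (σ₁ ⇒ σ₂) →
             Σ (S (σ₁ ⇒ σ₂) → C τ) λ g → ∀ {x y} → Geq (σ₁ ⇒ σ₂) x y → Cge τ (g x) (g y))
          λ f → ∀ {c d} → Cge (σ₁ ⇒ σ₂) c d → ∀ x → Cge τ (proj₁ (f c) x) (proj₁ (f d) x)

      Cge : (σ : Ty B) → C σ → C σ → Set
      Cge (base b) m n = n ≤ m
      Cge (base b ⇒ τ) f g = ∀ x → Cge τ (proj₁ f x) (proj₁ g x)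
      Cge ((σ₁ ⇒ σ₂) ⇒ τ) f g =
        ∀ c x → Cge τ (proj₁ (proj₁ f c) x) (proj₁ (proj₁ g c) x)

    SVal : Set
    SVal = (σ : Ty B) → ℕ → S σ

    CVal : Set
    CVal = (σ : Ty B) → ℕ → C σ

    module Interpretation (Js : (f : F) → S (ty f)) (Jc : (f : F) → C (ty f)) where

      size : SVal → ∀ {σ} → Tm σ → S σ
      size α (var {σ} n) = α σ n
      size α (fun f)     = Js f
      size α (app s t)   = proj₁ (size α s) (size α t)

      -- [[·]]^c ; for terms whose variables have order ≤ 1 this is
      -- exactly the paper's clause-wise definition (written compositionally)
      cost : SVal → CVal → ∀ {σ} → Tm σ → C σ
      cost α ζ (var {σ} n) = ζ σ n
      cost α ζ (fun f)     = Jc f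
      cost α ζ (app {base b} s t)    = proj₁ (cost α ζ s) (size α t)
      cost α ζ (app {σ₁ ⇒ σ₂} s t) = proj₁ (proj₁ (cost α ζ s) (cost α ζ t)) (size α t)

      baseCost : SVal → CVal → ∀ {σ} → Tm σ → ℕ
      baseCost α ζ {base b} s = cost α ζ s
      baseCost α ζ {_ ⇒ _}  s = 0

      𝒞 : SVal → CVal → ∀ {σ} → Tm σ → ℕ
      𝒞 α ζ (var n)   = 0
      𝒞 α ζ (fun f)   = baseCost α ζ (fun f)
      𝒞 α ζ (app s t) = baseCost α ζ (app s t) + 𝒞 α ζ s + 𝒞 α ζ t

      Compatible : (Rule → Set) → Set
      Compatible R = ∀ ρ → R ρ → (α : SVal) (ζ : CVal) →
        (𝒞 α ζ (Rule.rhs ρ) < cost α ζ (Rule.lhs ρ)) ×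
        (size α (Rule.lhs ρ) ⊒[ base (Rule.rty ρ) ] size α (Rule.rhs ρ))

      module WithNF (R : Rule → Set)
                    (nf? : ∀ {σ} (s : Tm σ) → Dec (Rewriting.NF R s)) where

        redCost : SVal → CVal → ∀ {σ} → Tm σ → ℕ
        redCost α ζ s with nf? s
        ... | yes _ = 0
        ... | no  _ = baseCost α ζ s

        𝒞′ : SVal → CVal → ∀ {σ} → Tm σ → ℕ
        𝒞′ α ζ (var n)   = 0
        𝒞′ α ζ (fun f)   = redCost α ζ (fun f)
        𝒞′ α ζ (app s t) = redCost α ζ (app s t) + 𝒞′ α ζ s + 𝒞′ α ζ t

-- A root step ℓγ → rγ is where cost strictly drops: by the substitution lemma, compatibility
-- gives 𝒞(r) < [[ℓ]]ᶜ under the valuations induced by γ, and innermost rewriting makes every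
-- γ(x) with x in r a normal form (its subterms are proper subterms of ℓγ), so such γ(x)
-- contribute nothing to 𝒞′(rγ).  Under a context, sizes are preserved by monotonicity of the
-- size functions, and costs of function type decrease pointwise, so the enclosing reducible
-- applications can only get cheaper while the rewritten subterm gets strictly cheaper.
module Submission where

open import Defs
open import Data.Nat using (_+_; _≤_; _<_; z≤n)
open import Data.Nat.Properties
  using (≤-refl; ≤-trans; ≤-reflexive; m≤m+n; +-mono-≤; +-mono-<-≤; +-mono-≤-<; module ≤-Reasoning)
open import Data.Product using (_×_; Σ; _,_; proj₁; proj₂)
open import Data.Empty using (⊥-elim)
open import Relation.Nullary using (Dec; yes; no; ¬_)
open import Relation.Binary.PropositionalEquality using (_≡_; refl; sym; cong₂; subst₂)

module _ {B : Set} {F : Set} {ty : F → Ty B} where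
  open Framework F ty

  ⊴-subst-var : ∀ {ρ n σ τ} {s : Tm σ} (γ : Subst) {u : Tm τ} →
                Occ ρ n s → u ⊴ γ ρ n → u ⊴ (s ⟨ γ ⟩)
  ⊴-subst-var γ here    u⊴ = u⊴
  ⊴-subst-var γ (inL o) u⊴ = ⊴-appL (⊴-subst-var γ o u⊴)
  ⊴-subst-var γ (inR o) u⊴ = ⊴-appR (⊴-subst-var γ o u⊴)

  ◁-subst-var : ∀ {ρ n σ τ} {s : Tm σ} (γ : Subst) {u : Tm τ} →
                FunHeaded s → Occ ρ n s → u ⊴ γ ρ n → u ◁ (s ⟨ γ ⟩)
  ◁-subst-var γ (app _) (inL o) u⊴ = ◁-appL (⊴-subst-var γ o u⊴)
  ◁-subst-var γ (app _) (inR o) u⊴ = ◁-appR (⊴-subst-var γ o u⊴)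

  FunHeaded-subst : ∀ {σ} {s : Tm σ} (γ : Subst) → FunHeaded s → FunHeaded (s ⟨ γ ⟩)
  FunHeaded-subst γ (fun f) = fun f
  FunHeaded-subst γ (app h) = app (FunHeaded-subst γ h)

  module _ (R : Rule → Set) where
    open Rewriting R

    RedexFree : ∀ {σ} → Tm σ → Set
    RedexFree s = ∀ {τ} (u : Tm τ) → u ⊴ s → ¬ Redex u

    ⟶⇒redex-subterm : ∀ {σ} {s t : Tm σ} → s ⟶ t → Σ (Ty B) λ τ → Σ (Tm τ) λ u → u ⊴ s × Redex u
    ⟶⇒redex-subterm (root r γ _) = _ , _ , ⊴-refl , redex r γ
    ⟶⇒redex-subterm (appL st) with ⟶⇒redex-subterm st
    ... | τ , u , u⊴ , red = τ , u , ⊴-appL u⊴ , red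
    ⟶⇒redex-subterm (appR st) with ⟶⇒redex-subterm st
    ... | τ , u , u⊴ , red = τ , u , ⊴-appR u⊴ , red

    RedexFree⇒NF : ∀ {σ} {s : Tm σ} → RedexFree s → NF s
    RedexFree⇒NF free t st with ⟶⇒redex-subterm st
    ... | _ , u , u⊴ , red = free u u⊴ red

    RedexFree-appˡ : ∀ {σ τ} {s : Tm (σ ⇒ τ)} {t : Tm σ} → RedexFree (app s t) → RedexFree s
    RedexFree-appˡ free u u⊴ = free u (⊴-appL u⊴)

    RedexFree-appʳ : ∀ {σ τ} {s : Tm (σ ⇒ τ)} {t : Tm σ} → RedexFree (app s t) → RedexFree t
    RedexFree-appʳ free u u⊴ = free u (⊴-appR u⊴)

    innermost⇒RedexFree-var : ∀ {σ ρ n} {ℓ : Tm σ} (γ : Subst) →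
      FunHeaded ℓ → (∀ {τ} (u : Tm τ) → u ◁ (ℓ ⟨ γ ⟩) → ¬ Redex u) →
      Occ ρ n ℓ → RedexFree (γ ρ n)
    innermost⇒RedexFree-var γ head inner o u u⊴ = inner u (◁-subst-var γ head o u⊴)

module _ {B : Set} {F : Set} {ty : F → Ty B} (Q : B → QuasiOrder) where
  open Framework F ty
  open Domains Q

  Cge-trans : ∀ σ {a b c} → Cge σ a b → Cge σ b c → Cge σ a c
  Cge-trans (base _)      p q = ≤-trans q p
  Cge-trans (base _ ⇒ τ)  p q = λ x → Cge-trans τ (p x) (q x)
  Cge-trans ((_ ⇒ _) ⇒ τ) p q = λ c x → Cge-trans τ (p c x) (q c x)

module _ {B : Set} {F : Set} {ty : F → Ty B} (Q : B → QuasiOrder)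
         (Js : (f : F) → Framework.Domains.S F ty Q (ty f)) (Jc : (f : F) → Framework.Domains.C F ty Q (ty f))
         (α : Framework.Domains.SVal F ty Q) (ζ : Framework.Domains.CVal F ty Q) where
  open Framework F ty
  open Domains Q
  open Interpretation Js Jc

  substSVal : Subst → SVal
  substSVal γ σ n = size α (γ σ n)

  substCVal : Subst → CVal
  substCVal γ σ n = cost α ζ (γ σ n)

  size-subst : ∀ γ {σ} (s : Tm σ) → size α (s ⟨ γ ⟩) ≡ size (substSVal γ) s
  size-subst γ (var n)   = refl
  size-subst γ (fun f)   = refl
  size-subst γ (app s t) = cong₂ proj₁ (size-subst γ s) (size-subst γ t)

  cost-subst : ∀ γ {σ} (s : Tm σ) → cost α ζ (s ⟨ γ ⟩) ≡ cost (substSVal γ) (substCVal γ) s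
  cost-subst γ (var n) = refl
  cost-subst γ (fun f) = refl
  cost-subst γ (app {base _} s t) = cong₂ proj₁ (cost-subst γ s) (size-subst γ t)
  cost-subst γ (app {_ ⇒ _} s t) =
    cong₂ proj₁ (cong₂ proj₁ (cost-subst γ s) (cost-subst γ t)) (size-subst γ t)

  baseCost-subst : ∀ γ {σ} (s : Tm σ) →
                   baseCost α ζ (s ⟨ γ ⟩) ≡ baseCost (substSVal γ) (substCVal γ) s
  baseCost-subst γ {base _} s = cost-subst γ s
  baseCost-subst γ {_ ⇒ _}  s = refl

  baseCost-mono : ∀ {σ} {s t : Tm σ} → Cge σ (cost α ζ s) (cost α ζ t) →
                  baseCost α ζ t ≤ baseCost α ζ s
  baseCost-mono {base _} s≥t = s≥t
  baseCost-mono {_ ⇒ _}  _   = z≤n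

  cost-app-monoˡ : ∀ {ρ σ} {s u : Tm (ρ ⇒ σ)} (t : Tm ρ) →
    Cge (ρ ⇒ σ) (cost α ζ s) (cost α ζ u) → Cge σ (cost α ζ (app s t)) (cost α ζ (app u t))
  cost-app-monoˡ {base _} t s≥u = s≥u (size α t)
  cost-app-monoˡ {_ ⇒ _}  t s≥u = s≥u (cost α ζ t) (size α t)

  module _ (R : Rule → Set) (compatible : Compatible R) where
    open Rewriting R

    size-⊒ : ∀ {σ} {s t : Tm σ} → s ⟶ t → size α s ⊒[ σ ] size α t
    size-⊒ (root {ρ} r γ _) =
      subst₂ (Geq (base rty)) (sym (size-subst γ lhs)) (sym (size-subst γ rhs))
             (proj₂ (compatible ρ r (substSVal γ) (substCVal γ)))
      where open Rule ρ
    size-⊒ (appL {t = t} su) = size-⊒ su (size α t)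
    size-⊒ (appR {t = t} su) = proj₂ (size α t) (size-⊒ su)

    -- Not at base type, where a root step ℓγ → xγ may raise the cost; at function type
    -- there are no root steps, since rules have base type.
    mutual
      cost-⊒ : ∀ {ρ σ} {s t : Tm (ρ ⇒ σ)} → s ⟶ t → Cge (ρ ⇒ σ) (cost α ζ s) (cost α ζ t)
      cost-⊒ (appL {t = t} su) = cost-app-monoˡ t (cost-⊒ su)
      cost-⊒ (appR {t = t} su) = cost-app-monoʳ t su

      cost-app-monoʳ : ∀ {ρ σ} (t : Tm (ρ ⇒ σ)) {s u : Tm ρ} →
        s ⟶ u → Cge σ (cost α ζ (app t s)) (cost α ζ (app t u))
      cost-app-monoʳ {base _} t su = proj₂ (cost α ζ t) (size-⊒ su)
      cost-app-monoʳ {_ ⇒ _} {σ} t {s} {u} su =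
        Cge-trans Q σ (proj₂ (cost α ζ t) (cost-⊒ su) (size α s))
                    (proj₂ (proj₁ (cost α ζ t) (cost α ζ u)) (size-⊒ su))

    module _ (nf? : ∀ {σ} (s : Tm σ) → Dec (NF s)) where
      open WithNF R nf?

      redCost≤baseCost : ∀ {σ} (s : Tm σ) → redCost α ζ s ≤ baseCost α ζ s
      redCost≤baseCost s with nf? s
      ... | yes _ = z≤n
      ... | no  _ = ≤-refl

      redCost-reducible : ∀ {σ} {s t : Tm σ} → s ⟶ t → redCost α ζ s ≡ baseCost α ζ s
      redCost-reducible {s = s} {t} st with nf? s
      ... | yes nf = ⊥-elim (nf t st)
      ... | no  _  = refl

      redCost-mono : ∀ {σ} {s s′ t : Tm σ} → s ⟶ s′ → Cge σ (cost α ζ s) (cost α ζ t) →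
                     redCost α ζ t ≤ redCost α ζ s
      redCost-mono {s = s} {t = t} st s≥t = begin
        redCost α ζ t   ≤⟨ redCost≤baseCost t ⟩
        baseCost α ζ t  ≤⟨ baseCost-mono s≥t ⟩
        baseCost α ζ s  ≡⟨ sym (redCost-reducible st) ⟩
        redCost α ζ s   ∎
        where open ≤-Reasoning

      redCost≤𝒞′ : ∀ {σ} {s : Tm σ} → FunHeaded s → redCost α ζ s ≤ 𝒞′ α ζ s
      redCost≤𝒞′ (fun f) = ≤-refl
      redCost≤𝒞′ (app _) = ≤-trans (m≤m+n _ _) (m≤m+n _ _)

      RedexFree⇒redCost≡0 : ∀ {σ} (s : Tm σ) → RedexFree R s → redCost α ζ s ≡ 0
      RedexFree⇒redCost≡0 s free with nf? s
      ... | yes _   = refl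
      ... | no  ¬nf = ⊥-elim (¬nf (RedexFree⇒NF R free))

      RedexFree⇒𝒞′≡0 : ∀ {σ} (s : Tm σ) → RedexFree R s → 𝒞′ α ζ s ≡ 0
      RedexFree⇒𝒞′≡0 (var n)   free = refl
      RedexFree⇒𝒞′≡0 (fun f)   free = RedexFree⇒redCost≡0 (fun f) free
      RedexFree⇒𝒞′≡0 (app s t) free =
        cong₂ _+_ (cong₂ _+_ (RedexFree⇒redCost≡0 (app s t) free)
                             (RedexFree⇒𝒞′≡0 s (RedexFree-appˡ R free)))
                  (RedexFree⇒𝒞′≡0 t (RedexFree-appʳ R free))

      redCost-subst≤baseCost : ∀ γ {σ} (s : Tm σ) →
                               redCost α ζ (s ⟨ γ ⟩) ≤ baseCost (substSVal γ) (substCVal γ) s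
      redCost-subst≤baseCost γ s =
        ≤-trans (redCost≤baseCost (s ⟨ γ ⟩)) (≤-reflexive (baseCost-subst γ s))

      𝒞′-subst≤𝒞 : ∀ γ {σ} (r : Tm σ) → (∀ ρ n → Occ ρ n r → 𝒞′ α ζ (γ ρ n) ≡ 0) →
                   𝒞′ α ζ (r ⟨ γ ⟩) ≤ 𝒞 (substSVal γ) (substCVal γ) r
      𝒞′-subst≤𝒞 γ (var {σ} n) vanish = ≤-reflexive (vanish σ n here)
      𝒞′-subst≤𝒞 γ (fun f)     vanish = redCost-subst≤baseCost γ (fun f)
      𝒞′-subst≤𝒞 γ (app r₁ r₂) vanish =
        +-mono-≤ (+-mono-≤ (redCost-subst≤baseCost γ (app r₁ r₂))
                           (𝒞′-subst≤𝒞 γ r₁ (λ ρ n o → vanish ρ n (inL o))))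
                 (𝒞′-subst≤𝒞 γ r₂ (λ ρ n o → vanish ρ n (inR o)))

      𝒞′-root-decreasing : ∀ {ρ} → R ρ → (γ : Subst) →
        (∀ {τ} (u : Tm τ) → u ◁ (Rule.lhs ρ ⟨ γ ⟩) → ¬ Redex u) →
        𝒞′ α ζ (Rule.rhs ρ ⟨ γ ⟩) < 𝒞′ α ζ (Rule.lhs ρ ⟨ γ ⟩)
      𝒞′-root-decreasing {ρ} r γ inner = begin-strict
        𝒞′ α ζ (rhs ⟨ γ ⟩)                    ≤⟨ 𝒞′-subst≤𝒞 γ rhs rhs-vars-vanish ⟩
        𝒞 (substSVal γ) (substCVal γ) rhs     <⟨ proj₁ (compatible ρ r (substSVal γ) (substCVal γ)) ⟩
        cost (substSVal γ) (substCVal γ) lhs  ≡⟨ sym (cost-subst γ lhs) ⟩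
        baseCost α ζ (lhs ⟨ γ ⟩)              ≡⟨ sym (redCost-reducible (root r γ inner)) ⟩
        redCost α ζ (lhs ⟨ γ ⟩)               ≤⟨ redCost≤𝒞′ (FunHeaded-subst γ lhs-head) ⟩
        𝒞′ α ζ (lhs ⟨ γ ⟩)                    ∎
        where
        open Rule ρ
        open ≤-Reasoning
        rhs-vars-vanish : ∀ ρ′ n → Occ ρ′ n rhs → 𝒞′ α ζ (γ ρ′ n) ≡ 0
        rhs-vars-vanish ρ′ n o =
          RedexFree⇒𝒞′≡0 (γ ρ′ n) (innermost⇒RedexFree-var R γ lhs-head inner (rhs-vars ρ′ n o))

      𝒞′-decreasing : ∀ {σ} {s t : Tm σ} → s ⟶ t → 𝒞′ α ζ t < 𝒞′ α ζ s
      𝒞′-decreasing (root r γ inner) = 𝒞′-root-decreasing r γ inner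
      𝒞′-decreasing st@(appL {t = t} su) =
        +-mono-<-≤ (+-mono-≤-< (redCost-mono st (cost-app-monoˡ t (cost-⊒ su)))
                               (𝒞′-decreasing su))
                   ≤-refl
      𝒞′-decreasing st@(appR {t = t} su) =
        +-mono-≤-< (+-mono-≤ (redCost-mono st (cost-app-monoʳ t su)) ≤-refl)
                   (𝒞′-decreasing su)

theorem3p1 :
    (B : Set) → B →
    (F : Set) (ty : F → Ty B) → (∀ f → ord (ty f) ≤ 2) →
    let open Framework F ty in
    (R : Rule → Set) →
    (∀ ρ → R ρ → VarsOrd≤1 (Rule.lhs ρ)) →
    (Q : B → QuasiOrder) →
    let open Domains Q in
    (Js : (f : F) → S (ty f)) (Jc : (f : F) → C (ty f)) →
    let open Interpretation Js Jc in
    Compatible R →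
    (nf? : ∀ {σ} (s : Tm σ) → Dec (Rewriting.NF R s)) →
    let open WithNF R nf? in
    (α : SVal) (ζ : CVal) {σ : Ty B} (s t : Tm σ) →
    VarsOrd≤1 s → VarsOrd≤1 t →
    Rewriting._⟶_ R s t →
    (𝒞′ α ζ t < 𝒞′ α ζ s) × (size α s ⊒[ σ ] size α t)
theorem3p1 B _ F ty _ R _ Q Js Jc compatible nf? α ζ s t _ _ s⟶t =
  𝒞′-decreasing Q Js Jc α ζ R compatible nf? s⟶t , size-⊒ Q Js Jc α ζ R compatible s⟶t
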